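{- Every forest is $i$-graph realizable: for every forest $F$ there exists a graph $G$ with $\mathcal{I}(G)\cong F$.
   Context: All graphs are finite and simple. For a graph $G$, $i(G)$ denotes the minimum cardinality of an independent dominating set of $G$; an independent dominating set of cardinality $i(G)$ is an $i$-set of $G$. The $i$-graph $\mathcal{I}(G)$ of $G$ is the graph whose vertices are the $i$-sets of $G$, where two $i$-sets $S$ and $S'$ are adjacent if and only if there is an edge $xy\in E(G)$ with $S'=(S-\{x\})\cup\{y\}$. A graph $H$ is $i$-graph realizable if there exists a graph $G$ with $\mathcal{I}(G)\cong H$. -}

module Defs where

open import Data.Nat using (ℕ; zero; suc; _≤_)
open import Data.Bool using (Bool; true; false; T)
open import Data.Fin using (Fin; zero; suc; inject₁; fromℕ)
open import Data.Fin.Subset using (Subset; _∈_; _∉_; ∣_∣; ⁅_⁆; _∪_; _─_)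
open import Data.Product using (Σ; ∃; _×_; _,_)
open import Data.Sum using (_⊎_)
open import Data.Empty using (⊥)
open import Relation.Nullary using (¬_)
open import Relation.Binary.PropositionalEquality using (_≡_; _≢_)
open import Function.Definitions using (Injective)
open import Function.Bundles using (_⇔_)

record Graph (n : ℕ) : Set where
  field
    adj     : Fin n → Fin n → Bool
    irrefl  : ∀ x → adj x x ≡ false
    sym     : ∀ x y → adj x y ≡ adj y x

open Graph public

Adj : ∀ {n} → Graph n → Fin n → Fin n → Set
Adj G x y = T (adj G x y)

Independent : ∀ {n} → Graph n → Subset n → Set
Independent G S = ∀ x y → x ∈ S → y ∈ S → ¬ Adj G x y

Dominating : ∀ {n} → Graph n → Subset n → Set
Dominating G S = ∀ v → v ∈ S ⊎ Σ (Fin _) (λ u → u ∈ S × Adj G u v)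

IndependentDominating : ∀ {n} → Graph n → Subset n → Set
IndependentDominating G S = Independent G S × Dominating G S

IsISet : ∀ {n} → Graph n → Subset n → Set
IsISet G S = IndependentDominating G S
           × (∀ T → IndependentDominating G T → ∣ S ∣ ≤ ∣ T ∣)

-- Adjacency in the i-graph: S and S' are distinct i-sets with
-- S' = (S - {x}) ∪ {y} for some edge xy of G.
-- (The i-graph is simple, so loops S = S' are excluded.)
IAdj : ∀ {n} → Graph n → Subset n → Subset n → Set
IAdj G S S' = S ≢ S'
  × Σ (Fin _) (λ x → Σ (Fin _) (λ y → Adj G x y × S' ≡ ((S ─ ⁅ x ⁆) ∪ ⁅ y ⁆)))

-- A cycle of length k+3 in G: an injective cyclic sequence of vertices
-- with consecutive vertices adjacent.
Cycle : ∀ {n} → Graph n → ℕ → Set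
Cycle {n} G k = Σ (Fin (suc (suc (suc k))) → Fin n) λ c →
    Injective _≡_ _≡_ c
  × (∀ (i : Fin (suc (suc k))) → Adj G (c (inject₁ i)) (c (suc i)))
  × Adj G (c (fromℕ (suc (suc k)))) (c zero)

Forest : ∀ {n} → Graph n → Set
Forest G = ∀ k → ¬ Cycle G k

IGraphIso : ∀ {n m} → Graph n → Graph m → Set
IGraphIso {n} {m} G H = Σ (Fin m → Subset n) λ f →
    (∀ u → IsISet G (f u))
  × Injective _≡_ _≡_ f
  × (∀ S → IsISet G S → Σ (Fin m) λ u → f u ≡ S)
  × (∀ u v → Adj H u v ⇔ IAdj G (f u) (f v))

IRealizable : ∀ {m} → Graph m → Set
IRealizable H = Σ ℕ λ n → Σ (Graph n) λ G → IGraphIso G H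

{-# OPTIONS --safe #-}
-- A graph H is an i-graph as soon as it is the flip graph of a binary Boolean constraint
-- system: distinct solutions a_u (u ∈ H) exhausting all solutions, with u ~ w iff a_u and
-- a_w differ in exactly one variable. For then give every variable a copy of K₄ minus an
-- edge, whose two non-adjacent vertices are pads and whose other two are its literals,
-- and join literals of distinct variables whose values a constraint forbids together. An independent dominating set meets every gadget, and a gadget without a
-- literal in the set contains both pads; so an i-set takes exactly one literal per gadget,
-- the i-sets are the literal sets of the solutions, and a swap along an edge flips one
-- variable.
-- Forests are flip graphs by induction: remove a vertex v of degree at most one (it
-- exists, since a non-backtracking walk that never gets stuck closes a cycle) and prepend
-- a variable marking v, which pins the others to the solution of v's neighbour, and a
-- second one which, when v is isolated, keeps v two flips away from everything else.

module Submission where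

open import Defs hiding (sym)
open import Data.Nat using (ℕ; zero; suc; _+_; _*_; _∸_; _≤_; _<_; z≤n; s≤s; s≤s⁻¹)
import Data.Nat.Properties as ℕ
open import Data.Bool using (Bool; true; false; T; _∧_; _∨_; _xor_)
import Data.Bool as Bool
open import Data.Bool.Properties using (xor-same; xor-comm; ∨-comm; ¬-not; T-∨; T-∧)
open import Data.Fin using (Fin; zero; suc; combine; remQuot; punchIn; punchOut; toℕ; fromℕ<; inject₁; fromℕ)
  renaming (_≟_ to _≟ᶠ_)
open import Data.Fin.Properties
  using (remQuot-combine; combine-remQuot; combine-injectiveˡ; suc-injective;
         punchIn-punchOut; punchInᵢ≢i; punchOut-cong; punchOut-punchIn; punchIn-injective; any?;
         all?; ¬∀⟶∃¬-smallest; ¬∀⟶∃¬; pigeonhole;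
         toℕ-inject; toℕ-fromℕ<; toℕ-inject₁; toℕ-fromℕ; toℕ<n; toℕ-injective)
open import Data.Fin.Subset using (Subset; inside; outside; _∈_; _∉_; ∣_∣; ⁅_⁆; _∪_; _─_)
open import Data.Fin.Subset.Properties
  using (_∈?_; ∣p∣≤∣x∷p∣; x∈⁅x⁆; x∈⁅y⁆⇒x≡y; x≢y⇒x∉⁅y⁆; x∈p∪q⁺; x∈p∪q⁻;
         x∈p∧x∉q⇒x∈p─q; p─q⊆p; ⊆-antisym)
open import Data.Vec using (Vec; []; _∷_; _++_; lookup; tabulate; there)
open import Data.Vec.Properties using (lookup∘tabulate; tabulate∘lookup; tabulate-cong; []=⇒lookup; lookup⇒[]=)
open import Data.Vec.Functional using (Vector; tail) renaming (_∷_ to _◂_)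
open import Data.Product using (∃; ∃₂; _×_; _,_; proj₁; proj₂)
open import Data.Sum using (_⊎_; inj₁; inj₂)
open import Data.Unit using (tt)
open import Relation.Nullary using (¬_; Dec; yes; no; does; contradiction)
open import Relation.Nullary.Decidable using (dec-true; dec-false; map′; T?; ¬?; decidable-stable; _→-dec_)
open import Relation.Binary.Definitions using (DecidableEquality; tri<; tri≈; tri>)
open import Relation.Binary.PropositionalEquality
open import Function.Base using (_∘_)
open import Function.Bundles using (_⇔_; mk⇔; Equivalence)
open import Function.Properties.Equivalence using () renaming (trans to ⇔-trans; sym to ⇔-sym)
open import Algebra.Properties.Monoid.Sum ℕ.+-0-monoid using (sum)

T-xor⁺ : ∀ {x y} → x ≢ y → T (x xor y)
T-xor⁺ {false} {false} x≢y = x≢y refl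
T-xor⁺ {false} {true}  _   = tt
T-xor⁺ {true}  {false} _   = tt
T-xor⁺ {true}  {true}  x≢y = x≢y refl

T-xor⁻ : ∀ {x y} → T (x xor y) → x ≢ y
T-xor⁻ {false} () refl
T-xor⁻ {true}  () refl

sum≥length : ∀ {k} (f : Vector ℕ k) → (∀ i → 1 ≤ f i) → k ≤ sum f
sum≥length {zero}  f 1≤f = z≤n
sum≥length {suc k} f 1≤f = ℕ.+-mono-≤ (1≤f zero) (sum≥length (tail f) (1≤f ∘ suc))

sum-ones : ∀ {k} (f : Vector ℕ k) → (∀ i → f i ≡ 1) → sum f ≡ k
sum-ones {zero}  f f≡1 = refl
sum-ones {suc k} f f≡1 = cong₂ _+_ (f≡1 zero) (sum-ones (tail f) (f≡1 ∘ suc))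

sum≤length⇒ones : ∀ {k} (f : Vector ℕ k) → (∀ i → 1 ≤ f i) → sum f ≤ k → ∀ i → f i ≡ 1
sum≤length⇒ones {suc k} f 1≤f sum≤ zero =
  ℕ.≤-antisym (ℕ.+-cancelʳ-≤ k (f zero) 1 (ℕ.≤-trans (ℕ.+-monoʳ-≤ (f zero) k≤sum) sum≤)) (1≤f zero)
  where k≤sum = sum≥length (tail f) (1≤f ∘ suc)
sum≤length⇒ones {suc k} f 1≤f sum≤ (suc i) =
  sum≤length⇒ones (tail f) (1≤f ∘ suc) (s≤s⁻¹ (ℕ.≤-trans (ℕ.+-monoˡ-≤ (sum (tail f)) (1≤f zero)) sum≤)) i

∣++∣ : ∀ {m n} (p : Subset m) (q : Subset n) → ∣ p ++ q ∣ ≡ ∣ p ∣ + ∣ q ∣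
∣++∣ []            q = refl
∣++∣ (outside ∷ p) q = ∣++∣ p q
∣++∣ (inside ∷ p)  q = cong suc (∣++∣ p q)

lookup-extensional : ∀ {A : Set} {n} (xs ys : Vec A n) → lookup xs ≗ lookup ys → xs ≡ ys
lookup-extensional xs ys eq = trans (sym (tabulate∘lookup xs)) (trans (tabulate-cong eq) (tabulate∘lookup ys))

x∈p─q⇒x∉q : ∀ {n} {x : Fin n} (p q : Subset n) → x ∈ p ─ q → x ∉ q
x∈p─q⇒x∉q {x = zero}  (inside ∷ p) (outside ∷ q) _ ()
x∈p─q⇒x∉q {x = suc x} (_ ∷ p)      (_ ∷ q)       (there x∈) (there x∈q) = x∈p─q⇒x∉q p q x∈ x∈q

-- Binary constraint systems and their flip graphs

Assignment : ℕ → Set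
Assignment k = Fin k → Bool

-- c i x j y = true forbids the values x at i and y at j together.
Constraints : ℕ → Set
Constraints k = Fin k → Bool → Fin k → Bool → Bool

Satisfies : ∀ {k} → Constraints k → Assignment k → Set
Satisfies c a = ∀ i j → i ≢ j → ¬ T (c i (a i) j (a j))

FlipAdjacent : ∀ {k} → Assignment k → Assignment k → Set
FlipAdjacent a b = ∃ λ i → a i ≢ b i × (∀ j → j ≢ i → a j ≡ b j)

record FlipRepresentation {n} (H : Graph n) : Set where
  field
    size               : ℕ
    constraints        : Constraints size
    solution           : Fin n → Assignment size
    solution-satisfies : ∀ u → Satisfies constraints (solution u)
    solution-complete  : ∀ a → Satisfies constraints a → ∃ λ u → a ≗ solution u
    solution-injective : ∀ {u w} → solution u ≗ solution w → u ≡ w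
    adj⇔flipAdjacent   : ∀ u w → Adj H u w ⇔ FlipAdjacent (solution u) (solution w)

-- The gadget graph

data Slot : Set where
  lit       : Bool → Slot
  pad₁ pad₂ : Slot

slotIndex : Slot → Fin 4
slotIndex (lit false) = zero
slotIndex (lit true)  = suc zero
slotIndex pad₁        = suc (suc zero)
slotIndex pad₂        = suc (suc (suc zero))

slotAt : Fin 4 → Slot
slotAt zero                   = lit false
slotAt (suc zero)             = lit true
slotAt (suc (suc zero))       = pad₁
slotAt (suc (suc (suc zero))) = pad₂

slotAt-slotIndex : ∀ s → slotAt (slotIndex s) ≡ s
slotAt-slotIndex (lit false) = refl
slotAt-slotIndex (lit true)  = refl
slotAt-slotIndex pad₁        = refl
slotAt-slotIndex pad₂        = refl

slotIndex-slotAt : ∀ j → slotIndex (slotAt j) ≡ j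
slotIndex-slotAt zero                   = refl
slotIndex-slotAt (suc zero)             = refl
slotIndex-slotAt (suc (suc zero))       = refl
slotIndex-slotAt (suc (suc (suc zero))) = refl

slotIndex-injective : ∀ {s t} → slotIndex s ≡ slotIndex t → s ≡ t
slotIndex-injective {s} {t} eq =
  trans (sym (slotAt-slotIndex s)) (trans (cong slotAt eq) (slotAt-slotIndex t))

_≟ˢ_ : DecidableEquality Slot
s ≟ˢ t = map′ slotIndex-injective (cong slotIndex) (slotIndex s ≟ᶠ slotIndex t)

lit-injective : ∀ {x y} → lit x ≡ lit y → x ≡ y
lit-injective refl = refl

slotAdj : Slot → Slot → Bool
slotAdj (lit x) (lit y) = x xor y
slotAdj (lit _) _       = true
slotAdj _       (lit _) = true
slotAdj _       _       = false

slotAdj-irrefl : ∀ s → slotAdj s s ≡ false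
slotAdj-irrefl (lit x) = xor-same x
slotAdj-irrefl pad₁    = refl
slotAdj-irrefl pad₂    = refl

slotAdj-sym : ∀ s t → slotAdj s t ≡ slotAdj t s
slotAdj-sym (lit x) (lit y) = xor-comm x y
slotAdj-sym (lit _) pad₁    = refl
slotAdj-sym (lit _) pad₂    = refl
slotAdj-sym pad₁    (lit _) = refl
slotAdj-sym pad₁    pad₁    = refl
slotAdj-sym pad₁    pad₂    = refl
slotAdj-sym pad₂    (lit _) = refl
slotAdj-sym pad₂    pad₁    = refl
slotAdj-sym pad₂    pad₂    = refl

lit-adjacent : ∀ b s → s ≢ lit b → T (slotAdj (lit b) s)
lit-adjacent b (lit c) s≢b = T-xor⁺ (λ b≡c → s≢b (cong lit (sym b≡c)))
lit-adjacent b pad₁    _   = tt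
lit-adjacent b pad₂    _   = tt

NonLit : Slot → Set
NonLit s = ∀ b → s ≢ lit b

nonLit-neighbour : ∀ {s p} → NonLit p → T (slotAdj s p) → ∃ λ b → s ≡ lit b
nonLit-neighbour {lit b} _ _ = b , refl
nonLit-neighbour {pad₁} {lit c} nonLit _ = contradiction refl (nonLit c)
nonLit-neighbour {pad₂} {lit c} nonLit _ = contradiction refl (nonLit c)

module _ {k : ℕ} where

  vertex : Fin k → Slot → Fin (k * 4)
  vertex i s = combine i (slotIndex s)

  gadgetOf : Fin (k * 4) → Fin k
  gadgetOf v = proj₁ (remQuot {k} 4 v)

  slotOf : Fin (k * 4) → Slot
  slotOf v = slotAt (proj₂ (remQuot {k} 4 v))

  gadgetOf-vertex : ∀ i s → gadgetOf (vertex i s) ≡ i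
  gadgetOf-vertex i s = cong proj₁ (remQuot-combine i (slotIndex s))

  slotOf-vertex : ∀ i s → slotOf (vertex i s) ≡ s
  slotOf-vertex i s = trans (cong (slotAt ∘ proj₂) (remQuot-combine i (slotIndex s))) (slotAt-slotIndex s)

  vertex-locate : ∀ v → vertex (gadgetOf v) (slotOf v) ≡ v
  vertex-locate v = trans (cong (combine (gadgetOf v)) (slotIndex-slotAt _)) (combine-remQuot {k} 4 v)

  vertex-elim : {P : Fin (k * 4) → Set} → (∀ i s → P (vertex i s)) → ∀ v → P v
  vertex-elim {P} P-vertex v = subst P (vertex-locate v) (P-vertex (gadgetOf v) (slotOf v))

  vertex-injectiveˡ : ∀ {i j s t} → vertex i s ≡ vertex j t → i ≡ j
  vertex-injectiveˡ {i} {j} {s} {t} = combine-injectiveˡ i (slotIndex s) j (slotIndex t)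

  gadgetSlice : Subset (k * 4) → Fin k → Subset 4
  gadgetSlice X i = tabulate (λ j → lookup X (combine i j))

-- combine lays the gadgets out as consecutive blocks of four.
∣∣≡sum-gadgetSlice : ∀ {k} (X : Subset (k * 4)) → ∣ X ∣ ≡ sum (λ i → ∣ gadgetSlice {k} X i ∣)
∣∣≡sum-gadgetSlice {zero}  []                     = refl
∣∣≡sum-gadgetSlice {suc k} (x₀ ∷ x₁ ∷ x₂ ∷ x₃ ∷ X) =
  trans (∣++∣ (x₀ ∷ x₁ ∷ x₂ ∷ x₃ ∷ []) X)
        (cong (∣ x₀ ∷ x₁ ∷ x₂ ∷ x₃ ∷ [] ∣ +_) (∣∣≡sum-gadgetSlice {k} X))

conflict : ∀ {k} → Constraints k → Fin k → Slot → Fin k → Slot → Bool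
conflict c i (lit x) j (lit y) = c i x j y
conflict c i _       j _       = false

T-conflict : ∀ {k} {c : Constraints k} {i j} s t → T (conflict c i s j t) →
             ∃₂ λ x y → s ≡ lit x × t ≡ lit y
T-conflict (lit x) (lit y) _ = x , y , refl , refl

gadgetAdj : ∀ {k} → Constraints k → Fin k → Slot → Fin k → Slot → Bool
gadgetAdj c i s j t with i ≟ᶠ j
... | yes _ = slotAdj s t
... | no  _ = conflict c i s j t ∨ conflict c j t i s

gadgetAdj-same : ∀ {k} (c : Constraints k) i s t → gadgetAdj c i s i t ≡ slotAdj s t
gadgetAdj-same c i s t with i ≟ᶠ i
... | yes _  = refl
... | no i≢i = contradiction refl i≢i

gadgetAdj-distinct : ∀ {k} (c : Constraints k) {i j} s t → i ≢ j →
                     gadgetAdj c i s j t ≡ (conflict c i s j t ∨ conflict c j t i s)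
gadgetAdj-distinct c {i} {j} s t i≢j with i ≟ᶠ j
... | yes i≡j = contradiction i≡j i≢j
... | no  _   = refl

gadgetAdj-sym : ∀ {k} (c : Constraints k) i s j t → gadgetAdj c i s j t ≡ gadgetAdj c j t i s
gadgetAdj-sym c i s j t with i ≟ᶠ j | j ≟ᶠ i
... | yes _   | yes _   = slotAdj-sym s t
... | yes i≡j | no  j≢i = contradiction (sym i≡j) j≢i
... | no  i≢j | yes j≡i = contradiction (sym j≡i) i≢j
... | no  _   | no  _   = ∨-comm (conflict c i s j t) _

gadgetGraph : ∀ {k} → Constraints k → Graph (k * 4)
gadgetGraph {k} c = record
  { adj    = λ v w → gadgetAdj c (g v) (σ v) (g w) (σ w)
  ; irrefl = λ v → trans (gadgetAdj-same c (g v) (σ v) (σ v)) (slotAdj-irrefl (σ v))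
  ; sym    = λ v w → gadgetAdj-sym c (g v) (σ v) (g w) (σ w)
  }
  where
  g = gadgetOf {k}
  σ = slotOf {k}

isChosenBy : ∀ {k} → Assignment k → Fin (k * 4) → Bool
isChosenBy {k} a v = does (slotOf {k} v ≟ˢ lit (a (gadgetOf {k} v)))

chosen : ∀ {k} → Assignment k → Subset (k * 4)
chosen a = tabulate (isChosenBy a)

PicksLiteral : ∀ {k} → Subset (k * 4) → Fin k → Bool → Set
PicksLiteral X i b = ∀ s → lookup X (vertex i s) ≡ does (s ≟ˢ lit b)

chosen-picks : ∀ {k} (a : Assignment k) i → PicksLiteral (chosen a) i (a i)
chosen-picks {k} a i s =
  trans (lookup∘tabulate (isChosenBy a) (vertex i s))
        (cong₂ (λ s′ i′ → does (s′ ≟ˢ lit (a i′))) (slotOf-vertex {k} i s) (gadgetOf-vertex {k} i s))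

module _ {k} {X : Subset (k * 4)} {i : Fin k} {b : Bool} (picks : PicksLiteral X i b) where

  picks⇒lit∈ : vertex i (lit b) ∈ X
  picks⇒lit∈ = lookup⇒[]= (vertex i (lit b)) X (trans (picks (lit b)) (dec-true (lit b ≟ˢ lit b) refl))

  picks-∈⇒≡lit : ∀ {s} → vertex i s ∈ X → s ≡ lit b
  picks-∈⇒≡lit {s} s∈X with s ≟ˢ lit b
  ... | yes s≡b = s≡b
  ... | no  s≢b =
    contradiction (trans (sym ([]=⇒lookup s∈X)) (trans (picks s) (dec-false (s ≟ˢ lit b) s≢b))) λ ()

  picks⇒∣gadgetSlice∣≡1 : ∣ gadgetSlice X i ∣ ≡ 1
  picks⇒∣gadgetSlice∣≡1 = trans (cong ∣_∣ (tabulate-cong slice≗)) (count b)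
    where
    slice≗ : ∀ j → lookup X (combine i j) ≡ does (slotAt j ≟ˢ lit b)
    slice≗ j = trans (cong (λ j′ → lookup X (combine i j′)) (sym (slotIndex-slotAt j))) (picks (slotAt j))
    count : ∀ b → ∣ tabulate (λ j → does (slotAt j ≟ˢ lit b)) ∣ ≡ 1
    count false = refl
    count true  = refl

pads⇒2≤∣gadgetSlice∣ : ∀ {k} {X : Subset (k * 4)} {i : Fin k} →
                       vertex i pad₁ ∈ X → vertex i pad₂ ∈ X → 2 ≤ ∣ gadgetSlice X i ∣
pads⇒2≤∣gadgetSlice∣ {X = X} {i} pad₁∈X pad₂∈X rewrite []=⇒lookup pad₁∈X | []=⇒lookup pad₂∈X =
  ℕ.≤-trans (∣p∣≤∣x∷p∣ x₁ (true ∷ true ∷ [])) (∣p∣≤∣x∷p∣ x₀ (x₁ ∷ true ∷ true ∷ []))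
  where
  x₀ = lookup X (vertex i (lit false))
  x₁ = lookup X (vertex i (lit true))

picksAll⇒≡chosen : ∀ {k} {X : Subset (k * 4)} (a : Assignment k) →
                   (∀ i → PicksLiteral X i (a i)) → X ≡ chosen a
picksAll⇒≡chosen {X = X} a picks =
  lookup-extensional X (chosen a) (vertex-elim {P = λ v → lookup X v ≡ lookup (chosen a) v}
                                    λ i s → trans (picks i s) (sym (chosen-picks a i s)))

chosen-cong : ∀ {k} {a b : Assignment k} → a ≗ b → chosen a ≡ chosen b
chosen-cong {k} a≗b = tabulate-cong λ v → cong (λ x → does (slotOf {k} v ≟ˢ lit x)) (a≗b (gadgetOf {k} v))

chosen-lit∈ : ∀ {k} (a : Assignment k) i → vertex i (lit (a i)) ∈ chosen a
chosen-lit∈ a i = picks⇒lit∈ {X = chosen a} {i} (chosen-picks a i)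

chosen-∈⇒≡lit : ∀ {k} (a : Assignment k) {i s} → vertex i s ∈ chosen a → s ≡ lit (a i)
chosen-∈⇒≡lit a {i} = picks-∈⇒≡lit {X = chosen a} {i} (chosen-picks a i)

chosen-injective : ∀ {k} {a b : Assignment k} → chosen a ≡ chosen b → a ≗ b
chosen-injective {a = a} {b} eq i = lit-injective (chosen-∈⇒≡lit b (subst (_ ∈_) eq (chosen-lit∈ a i)))

chosen-flip : ∀ {k} {a b : Assignment k} {i} → (∀ j → j ≢ i → a j ≡ b j) →
              chosen b ≡ (chosen a ─ ⁅ vertex i (lit (a i)) ⁆) ∪ ⁅ vertex i (lit (b i)) ⁆
chosen-flip {k} {a} {b} {i} agree =
  ⊆-antisym (λ {v} → vertex-elim {P = λ v → v ∈ chosen b → v ∈ flipped} into v)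
            (λ {v} → vertex-elim {P = λ v → v ∈ flipped → v ∈ chosen b} from v)
  where
  x y : Fin (k * 4)
  x = vertex i (lit (a i))
  y = vertex i (lit (b i))
  flipped = (chosen a ─ ⁅ x ⁆) ∪ ⁅ y ⁆

  into : ∀ (j : Fin k) s → vertex j s ∈ chosen b → vertex j s ∈ flipped
  into j s v∈b with chosen-∈⇒≡lit b v∈b
  ... | refl with j ≟ᶠ i
  ...   | yes refl = x∈p∪q⁺ (inj₂ (x∈⁅x⁆ y))
  ...   | no  j≢i  =
    x∈p∪q⁺ (inj₁ (x∈p∧x∉q⇒x∈p─q v∈a (x≢y⇒x∉⁅y⁆ (j≢i ∘ vertex-injectiveˡ))))
    where
    v∈a : vertex j (lit (b j)) ∈ chosen a
    v∈a = subst (λ c → vertex j (lit c) ∈ chosen a) (agree j j≢i) (chosen-lit∈ a j)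

  from : ∀ (j : Fin k) s → vertex j s ∈ flipped → vertex j s ∈ chosen b
  from j s v∈ with x∈p∪q⁻ (chosen a ─ ⁅ x ⁆) ⁅ y ⁆ v∈
  ... | inj₂ v∈y = subst (_∈ chosen b) (sym (x∈⁅y⁆⇒x≡y y v∈y)) (chosen-lit∈ b i)
  ... | inj₁ v∈a─x with chosen-∈⇒≡lit a (p─q⊆p (chosen a) ⁅ x ⁆ v∈a─x)
  ...   | refl with j ≟ᶠ i
  ...     | yes refl = contradiction (x∈⁅x⁆ x) (x∈p─q⇒x∉q (chosen a) ⁅ x ⁆ v∈a─x)
  ...     | no  j≢i  = subst (λ c → vertex j (lit c) ∈ chosen b) (sym (agree j j≢i)) (chosen-lit∈ b j)

module GadgetGraph {k} (c : Constraints k) where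

  G : Graph (k * 4)
  G = gadgetGraph c

  adj-vertex : ∀ i s j t → adj G (vertex i s) (vertex j t) ≡ gadgetAdj c i s j t
  adj-vertex i s j t rewrite gadgetOf-vertex i s | slotOf-vertex i s | gadgetOf-vertex j t | slotOf-vertex j t = refl

  gadget-adj : ∀ i {s t} → T (slotAdj s t) → Adj G (vertex i s) (vertex i t)
  gadget-adj i {s} {t} = subst T (sym (trans (adj-vertex i s i t) (gadgetAdj-same c i s t)))

  conflict-adj : ∀ {i j x y} → i ≢ j → T (c i x j y) → Adj G (vertex i (lit x)) (vertex j (lit y))
  conflict-adj {i} {j} {x} {y} i≢j cx =
    subst T (sym (trans (adj-vertex i (lit x) j (lit y)) (gadgetAdj-distinct c (lit x) (lit y) i≢j)))
          (Equivalence.from T-∨ (inj₁ cx))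

  lits-adj⁻ : ∀ {i j x y} → Adj G (vertex i (lit x)) (vertex j (lit y)) →
              (i ≡ j × x ≢ y) ⊎ (i ≢ j × (T (c i x j y) ⊎ T (c j y i x)))
  lits-adj⁻ {i} {j} {x} {y} xy with i ≟ᶠ j
  ... | yes refl = inj₁ (refl , T-xor⁻ (subst T (trans (adj-vertex i (lit x) i (lit y)) (gadgetAdj-same c i _ _)) xy))
  ... | no  i≢j  = inj₂ (i≢j , Equivalence.to T-∨
                    (subst T (trans (adj-vertex i (lit x) j (lit y)) (gadgetAdj-distinct c (lit x) (lit y) i≢j)) xy))

  nonLit-neighbours : ∀ {i p} → NonLit p → ∀ u → Adj G u (vertex i p) → ∃ λ b → u ≡ vertex i (lit b)
  nonLit-neighbours {i} {p} nonLit = vertex-elim λ j s up → neighbour j s (subst T (adj-vertex j s i p) up)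
    where
    neighbour : ∀ j s → T (gadgetAdj c j s i p) → ∃ λ b → vertex j s ≡ vertex i (lit b)
    neighbour j s sp with j ≟ᶠ i
    ... | yes refl = let (b , s≡b) = nonLit-neighbour nonLit sp in b , cong (vertex j) s≡b
    ... | no  _ with Equivalence.to T-∨ sp
    ...   | inj₁ csp = let (_ , _ , _ , p≡y) = T-conflict s p csp in contradiction p≡y (nonLit _)
    ...   | inj₂ cps = let (_ , _ , p≡x , _) = T-conflict p s cps in contradiction p≡x (nonLit _)

  chosen-∈ : ∀ (a : Assignment k) {v} → v ∈ chosen a → ∃ λ i → v ≡ vertex i (lit (a i))
  chosen-∈ a {v} = vertex-elim {P = λ v → v ∈ chosen a → ∃ λ i → v ≡ vertex i (lit (a i))}
                     (λ i s v∈ → i , cong (vertex i) (chosen-∈⇒≡lit a v∈)) v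

  chosen-independent : ∀ {a : Assignment k} → Satisfies c a → Independent G (chosen a)
  chosen-independent {a} sat v w v∈ w∈ vw with chosen-∈ a v∈ | chosen-∈ a w∈
  ... | i , refl | j , refl with lits-adj⁻ vw
  ...   | inj₁ (refl , a≢a)       = a≢a refl
  ...   | inj₂ (i≢j , inj₁ conf) = sat i j i≢j conf
  ...   | inj₂ (i≢j , inj₂ conf) = sat j i (i≢j ∘ sym) conf

  chosen-dominating : ∀ (a : Assignment k) → Dominating G (chosen a)
  chosen-dominating a = vertex-elim dominated
    where
    dominated : ∀ i s → vertex i s ∈ chosen a ⊎ ∃ λ u → u ∈ chosen a × Adj G u (vertex i s)
    dominated i s with s ≟ˢ lit (a i)
    ... | yes refl = inj₁ (chosen-lit∈ a i)
    ... | no  s≢a  = inj₂ (vertex i (lit (a i)) , chosen-lit∈ a i , gadget-adj i (lit-adjacent (a i) s s≢a))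

  lit∈⇒picks : ∀ {X} {i : Fin k} {b} → Independent G X → vertex i (lit b) ∈ X → PicksLiteral X i b
  lit∈⇒picks {X} {i} {b} ind b∈X s with s ≟ˢ lit b
  ... | yes refl = trans ([]=⇒lookup b∈X) (sym (dec-true (lit b ≟ˢ lit b) refl))
  ... | no  s≢b  =
    trans (¬-not λ s∈X → ind _ _ b∈X (lookup⇒[]= _ X s∈X) (gadget-adj i (lit-adjacent b s s≢b)))
          (sym (dec-false (s ≟ˢ lit b) s≢b))

  pad-dominated : ∀ {X} {i : Fin k} {p} → Dominating G X → NonLit p →
                  vertex i p ∈ X ⊎ ∃ λ b → vertex i (lit b) ∈ X
  pad-dominated {X} {i} {p} dom nonLit with dom (vertex i p)
  ... | inj₁ p∈X            = inj₁ p∈X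
  ... | inj₂ (u , u∈X , up) = let (b , u≡b) = nonLit-neighbours nonLit u up in inj₂ (b , subst (_∈ X) u≡b u∈X)

  gadget-shape : ∀ {X} → IndependentDominating G X → ∀ (i : Fin k) →
                 (∃ λ b → PicksLiteral X i b) ⊎ (vertex i pad₁ ∈ X × vertex i pad₂ ∈ X)
  gadget-shape {X} (ind , dom) i with vertex i (lit false) ∈? X | vertex i (lit true) ∈? X
  ... | yes f∈X | _       = inj₁ (false , lit∈⇒picks {X} {i} {false} ind f∈X)
  ... | no  _   | yes t∈X = inj₁ (true , lit∈⇒picks {X} {i} {true} ind t∈X)
  ... | no  f∉X | no  t∉X = inj₂ (pad∈X {pad₁} (λ _ ()) , pad∈X {pad₂} (λ _ ()))
    where
    pad∈X : ∀ {p} → NonLit p → vertex i p ∈ X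
    pad∈X nonLit with pad-dominated {X} {i} dom nonLit
    ... | inj₁ p∈X          = p∈X
    ... | inj₂ (false , f∈X) = contradiction f∈X f∉X
    ... | inj₂ (true  , t∈X) = contradiction t∈X t∉X

  1≤∣gadgetSlice∣ : ∀ {X} → IndependentDominating G X → ∀ (i : Fin k) → 1 ≤ ∣ gadgetSlice X i ∣
  1≤∣gadgetSlice∣ {X} indDom i with gadget-shape indDom i
  ... | inj₁ (b , picks)     = ℕ.≤-reflexive (sym (picks⇒∣gadgetSlice∣≡1 {X = X} {i} picks))
  ... | inj₂ (p₁∈X , p₂∈X) =
    ℕ.≤-trans (s≤s z≤n) (pads⇒2≤∣gadgetSlice∣ {k} {X} {i} p₁∈X p₂∈X)

  k≤∣X∣ : ∀ {X} → IndependentDominating G X → k ≤ ∣ X ∣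
  k≤∣X∣ {X} indDom =
    subst (k ≤_) (sym (∣∣≡sum-gadgetSlice {k} X)) (sum≥length _ (1≤∣gadgetSlice∣ indDom))

  ∣chosen∣≡k : ∀ (a : Assignment k) → ∣ chosen a ∣ ≡ k
  ∣chosen∣≡k a = trans (∣∣≡sum-gadgetSlice {k} (chosen a))
                       (sum-ones _ λ i → picks⇒∣gadgetSlice∣≡1 {X = chosen a} {i} (chosen-picks a i))

  chosen-isISet : ∀ {a : Assignment k} → Satisfies c a → IsISet G (chosen a)
  chosen-isISet {a} sat =
    (chosen-independent sat , chosen-dominating a) ,
    λ Y indDom → subst (_≤ ∣ Y ∣) (sym (∣chosen∣≡k a)) (k≤∣X∣ indDom)

  iSet⇒chosen : ∀ {a₀ : Assignment k} {X} → Satisfies c a₀ → IsISet G X →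
                ∃ λ a → Satisfies c a × X ≡ chosen a
  iSet⇒chosen {a₀} {X} sat₀ (indDom , minimal) = a , sat , X≡chosen
    where
    ∣X∣≤k : ∣ X ∣ ≤ k
    ∣X∣≤k = subst (∣ X ∣ ≤_) (∣chosen∣≡k a₀) (minimal (chosen a₀) (proj₁ (chosen-isISet sat₀)))
    slice≡1 : ∀ i → ∣ gadgetSlice X i ∣ ≡ 1
    slice≡1 =
      sum≤length⇒ones _ (1≤∣gadgetSlice∣ indDom) (subst (_≤ k) (∣∣≡sum-gadgetSlice {k} X) ∣X∣≤k)
    picks : ∀ i → ∃ λ b → PicksLiteral X i b
    picks i with gadget-shape indDom i
    ... | inj₁ picksᵢ          = picksᵢ
    ... | inj₂ (p₁∈X , p₂∈X) =
      contradiction (subst (2 ≤_) (slice≡1 i) (pads⇒2≤∣gadgetSlice∣ {k} {X} {i} p₁∈X p₂∈X)) λ { (s≤s ()) }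
    a : Assignment k
    a i = proj₁ (picks i)
    X≡chosen : X ≡ chosen a
    X≡chosen = picksAll⇒≡chosen a (proj₂ ∘ picks)
    lit∈X : ∀ i → vertex i (lit (a i)) ∈ X
    lit∈X i = subst (vertex i (lit (a i)) ∈_) (sym X≡chosen) (chosen-lit∈ a i)
    sat : Satisfies c a
    sat i j i≢j conf = proj₁ indDom _ _ (lit∈X i) (lit∈X j) (conflict-adj i≢j conf)

  flipAdjacent⇒iAdj : ∀ {a b : Assignment k} → FlipAdjacent a b → IAdj G (chosen a) (chosen b)
  flipAdjacent⇒iAdj (i , aᵢ≢bᵢ , agree) =
    (λ eq → aᵢ≢bᵢ (chosen-injective eq i)) , vertex i (lit _) , vertex i (lit _) ,
    gadget-adj i (T-xor⁺ aᵢ≢bᵢ) , chosen-flip agree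

  iAdj⇒flipAdjacent : ∀ {a b : Assignment k} → IAdj G (chosen a) (chosen b) → FlipAdjacent a b
  iAdj⇒flipAdjacent {a} {b} (a≢b , x , y , _ , b≡flipped) = i , aᵢ≢bᵢ , agree
    where
    i = gadgetOf {k} x
    agree : ∀ j → j ≢ i → a j ≡ b j
    agree j j≢i =
      lit-injective (chosen-∈⇒≡lit b (subst (_ ∈_) (sym b≡flipped) (x∈p∪q⁺ (inj₁ aⱼ∈a─x))))
      where
      aⱼ∈a─x : vertex j (lit (a j)) ∈ chosen a ─ ⁅ x ⁆
      aⱼ∈a─x = x∈p∧x∉q⇒x∈p─q (chosen-lit∈ a j)
                 (x≢y⇒x∉⁅y⁆ λ eq → j≢i (vertex-injectiveˡ {k} (trans eq (sym (vertex-locate {k} x)))))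
    aᵢ≢bᵢ : a i ≢ b i
    aᵢ≢bᵢ aᵢ≡bᵢ = a≢b (chosen-cong λ j → everywhere (j ≟ᶠ i))
      where
      everywhere : ∀ {j} → Dec (j ≡ i) → a j ≡ b j
      everywhere     (yes refl) = aᵢ≡bᵢ
      everywhere {j} (no  j≢i)  = agree j j≢i

flipRepresentation⇒iRealizable : ∀ {m} {H : Graph (suc m)} → FlipRepresentation H → IRealizable H
flipRepresentation⇒iRealizable R =
  size * 4 , G , chosen ∘ solution , chosen-isISet ∘ solution-satisfies ,
  (λ eq → solution-injective (chosen-injective eq)) , surjective ,
  λ u w → mk⇔ (flipAdjacent⇒iAdj ∘ Equivalence.to (adj⇔flipAdjacent u w))
              (Equivalence.from (adj⇔flipAdjacent u w) ∘ iAdj⇒flipAdjacent)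
  where
  open FlipRepresentation R
  open GadgetGraph constraints
  surjective : ∀ X → IsISet G X → ∃ λ u → chosen (solution u) ≡ X
  surjective X iSet =
    let (a , sat , X≡a) = iSet⇒chosen (solution-satisfies zero) iSet
        (u , a≗u)       = solution-complete a sat
    in u , sym (trans X≡a (chosen-cong a≗u))

-- Adding a vertex of degree at most one

◂-≗ : ∀ {k} {x y} {a b : Assignment k} → (x ◂ a) ≗ (y ◂ b) → x ≡ y × a ≗ b
◂-≗ eq = eq zero , eq ∘ suc

flipAdjacent-irrefl : ∀ {k} {a : Assignment k} → ¬ FlipAdjacent a a
flipAdjacent-irrefl (_ , aᵢ≢aᵢ , _) = aᵢ≢aᵢ refl

flipAdjacent-sym : ∀ {k} {a b : Assignment k} → FlipAdjacent a b → FlipAdjacent b a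
flipAdjacent-sym (i , aᵢ≢bᵢ , agree) = i , aᵢ≢bᵢ ∘ sym , λ j j≢i → sym (agree j j≢i)

flipAdjacent-◂ : ∀ {k} {x} {a b : Assignment k} → FlipAdjacent (x ◂ a) (x ◂ b) ⇔ FlipAdjacent a b
flipAdjacent-◂ {x = x} {a} {b} = mk⇔ to from
  where
  to : FlipAdjacent (x ◂ a) (x ◂ b) → FlipAdjacent a b
  to (zero  , x≢x , _)     = contradiction refl x≢x
  to (suc i , aᵢ≢bᵢ , agree) = i , aᵢ≢bᵢ , λ j j≢i → agree (suc j) (j≢i ∘ suc-injective)
  from : FlipAdjacent a b → FlipAdjacent (x ◂ a) (x ◂ b)
  from (i , aᵢ≢bᵢ , agree) = suc i , aᵢ≢bᵢ , λ where
    zero    _    → refl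
    (suc j) j≢i → agree j (j≢i ∘ cong suc)

flipAdjacent-head : ∀ {k} {x y} {a b : Assignment k} → x ≢ y → FlipAdjacent (x ◂ a) (y ◂ b) ⇔ a ≗ b
flipAdjacent-head {x = x} {y} {a} {b} x≢y = mk⇔ to from
  where
  to : FlipAdjacent (x ◂ a) (y ◂ b) → a ≗ b
  to (zero  , _ , agree) j = agree (suc j) λ ()
  to (suc i , _ , agree)   = contradiction (agree zero λ ()) x≢y
  from : a ≗ b → FlipAdjacent (x ◂ a) (y ◂ b)
  from a≗b = zero , x≢y , λ where
    zero    0≢0 → contradiction refl 0≢0
    (suc j) _   → a≗b j

-- Two new variables go in front. The first marks the new vertex and, when set, pins the
-- old variables to the anchor's solution; the second must equal the first when the new
-- vertex is isolated, which puts its solution two flips away from every other one.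
module ExtendedConstraints {k} (c : Constraints k) (anchor : Assignment k) (isolated : Bool) where

  extended : Constraints (suc (suc k))
  extended zero          x (suc (suc j)) y = x ∧ (y xor anchor j)
  extended (suc zero)    y zero          x = y xor (x ∧ isolated)
  extended (suc (suc i)) x (suc (suc j)) y = c i x j y
  extended _             _ _             _ = false

  satisfies-◂ : ∀ {x y a} → Satisfies c a → (T x → a ≗ anchor) → y ≡ x ∧ isolated →
                Satisfies extended (x ◂ y ◂ a)
  satisfies-◂ _   _     _     zero          zero          0≢0 _ = 0≢0 refl
  satisfies-◂ _   _     _     zero          (suc zero)    _   ()
  satisfies-◂ _   fixed _     zero          (suc (suc j)) _   conf =
    let (Tx , differs) = Equivalence.to T-∧ conf in T-xor⁻ differs (fixed Tx j)
  satisfies-◂ _   _     y≡x∧ (suc zero)    zero          _   conf = T-xor⁻ conf y≡x∧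
  satisfies-◂ _   _     _     (suc zero)    (suc zero)    1≢1 _ = 1≢1 refl
  satisfies-◂ _   _     _     (suc zero)    (suc (suc j)) _   ()
  satisfies-◂ _   _     _     (suc (suc i)) zero          _   ()
  satisfies-◂ _   _     _     (suc (suc i)) (suc zero)    _   ()
  satisfies-◂ sat _     _     (suc (suc i)) (suc (suc j)) i≢j conf =
    sat i j (i≢j ∘ cong (λ l → suc (suc l))) conf

  module _ {a : Assignment (suc (suc k))} (sat : Satisfies extended a) where

    satisfies-tail : Satisfies c (tail (tail a))
    satisfies-tail i j i≢j = sat (suc (suc i)) (suc (suc j)) (i≢j ∘ suc-injective ∘ suc-injective)

    satisfies-fixed : T (a zero) → tail (tail a) ≗ anchor
    satisfies-fixed Ta₀ j with a (suc (suc j)) Bool.≟ anchor j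
    ... | yes aⱼ≡ = aⱼ≡
    ... | no  aⱼ≢ = contradiction (Equivalence.from T-∧ (Ta₀ , T-xor⁺ aⱼ≢)) (sat zero (suc (suc j)) λ ())

    satisfies-copy : a (suc zero) ≡ a zero ∧ isolated
    satisfies-copy with a (suc zero) Bool.≟ (a zero ∧ isolated)
    ... | yes a₁≡ = a₁≡
    ... | no  a₁≢ = contradiction (T-xor⁺ a₁≢) (sat (suc zero) zero λ ())

deleteVertex : ∀ {n} → Graph (suc n) → Fin (suc n) → Graph n
deleteVertex F v = record
  { adj    = λ u w → adj F (punchIn v u) (punchIn v w)
  ; irrefl = λ u → irrefl F (punchIn v u)
  ; sym    = λ u w → Graph.sym F (punchIn v u) (punchIn v w)
  }

punchIn-cases : ∀ {n} (v w : Fin (suc n)) → v ≡ w ⊎ ∃ λ u → punchIn v u ≡ w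
punchIn-cases v w with v ≟ᶠ w
... | yes v≡w = inj₁ v≡w
... | no  v≢w = inj₂ (punchOut v≢w , punchIn-punchOut v≢w)

adj-irrefl : ∀ {n} (F : Graph n) {v} → ¬ Adj F v v
adj-irrefl F {v} = subst T (irrefl F v)

adj-sym : ∀ {n} (F : Graph n) {u w} → Adj F u w → Adj F w u
adj-sym F {u} {w} = subst T (Graph.sym F u w)

module ExtendRepresentation {n} (F : Graph (suc n)) (v : Fin (suc n)) (R : FlipRepresentation (deleteVertex F v))
  (anchor : Fin n) (isolated : Bool)
  (neighbourhood : ∀ u → Adj F v (punchIn v u) ⇔ (isolated ≡ false × u ≡ anchor)) where

  open FlipRepresentation R renaming
    ( size to size′; constraints to constraints′; solution to solution′; solution-satisfies to solution-satisfies′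
    ; solution-complete to solution-complete′; solution-injective to solution-injective′
    ; adj⇔flipAdjacent to adj⇔flipAdjacent′)
  open ExtendedConstraints constraints′ (solution′ anchor) isolated

  fresh : Assignment (suc (suc size′))
  fresh = true ◂ isolated ◂ solution′ anchor

  embed : Assignment size′ → Assignment (suc (suc size′))
  embed a = false ◂ false ◂ a

  solution : Fin (suc n) → Assignment (suc (suc size′))
  solution w with v ≟ᶠ w
  ... | yes _   = fresh
  ... | no  v≢w = embed (solution′ (punchOut v≢w))

  solution-v : solution v ≡ fresh
  solution-v with v ≟ᶠ v
  ... | yes _   = refl
  ... | no  v≢v = contradiction refl v≢v

  solution-punchIn : ∀ u → solution (punchIn v u) ≡ embed (solution′ u)
  solution-punchIn u with v ≟ᶠ punchIn v u
  ... | yes v≡u = contradiction (sym v≡u) (punchInᵢ≢i v u)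
  ... | no  v≢u = cong (embed ∘ solution′) (trans (punchOut-cong v refl) (punchOut-punchIn v))

  solution-satisfies : ∀ w → Satisfies extended (solution w)
  solution-satisfies w with punchIn-cases v w
  ... | inj₁ refl = subst (Satisfies extended) (sym solution-v)
                      (satisfies-◂ (solution-satisfies′ anchor) (λ _ _ → refl) refl)
  ... | inj₂ (u , refl) = subst (Satisfies extended) (sym (solution-punchIn u))
                            (satisfies-◂ (solution-satisfies′ u) (λ ()) refl)

  solution-complete : ∀ a → Satisfies extended a → ∃ λ w → a ≗ solution w
  solution-complete a sat with a zero in a₀≡
  ... | true  = v , λ j → trans (a≗fresh j) (sym (cong-app solution-v j))
    where
    a≗fresh : a ≗ fresh
    a≗fresh zero          = a₀≡
    a≗fresh (suc zero)    = trans (satisfies-copy sat) (cong (_∧ isolated) a₀≡)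
    a≗fresh (suc (suc j)) = satisfies-fixed sat (subst T (sym a₀≡) tt) j
  ... | false = punchIn v u , λ j → trans (a≗embed j) (sym (cong-app (solution-punchIn u) j))
    where
    u = proj₁ (solution-complete′ _ (satisfies-tail sat))
    a≗embed : a ≗ embed (solution′ u)
    a≗embed zero          = a₀≡
    a≗embed (suc zero)    = trans (satisfies-copy sat) (cong (_∧ isolated) a₀≡)
    a≗embed (suc (suc j)) = proj₂ (solution-complete′ _ (satisfies-tail sat)) j

  solution-injective : ∀ {u w} → solution u ≗ solution w → u ≡ w
  solution-injective {u} {w} eq with punchIn-cases v u | punchIn-cases v w
  ... | inj₁ refl        | inj₁ refl        = refl
  ... | inj₁ refl        | inj₂ (w′ , refl) = contradiction (trans (sym (cong-app solution-v zero))
                                                (trans (eq zero) (cong-app (solution-punchIn w′) zero))) λ ()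
  ... | inj₂ (u′ , refl) | inj₁ refl        = contradiction (trans (sym (cong-app solution-v zero))
                                                (trans (sym (eq zero)) (cong-app (solution-punchIn u′) zero))) λ ()
  ... | inj₂ (u′ , refl) | inj₂ (w′ , refl) = cong (punchIn v) (solution-injective′ λ j →
    trans (sym (cong-app (solution-punchIn u′) (suc (suc j))))
          (trans (eq (suc (suc j))) (cong-app (solution-punchIn w′) (suc (suc j)))))

  adj⇔flipAdjacent-fresh : ∀ u → Adj F v (punchIn v u) ⇔ FlipAdjacent fresh (embed (solution′ u))
  adj⇔flipAdjacent-fresh u = mk⇔
    (λ vu → let (isolated≡false , u≡anchor) = Equivalence.to (neighbourhood u) vu in
            Equivalence.from (flipAdjacent-head λ ()) λ where
              zero    → isolated≡false
              (suc j) → cong (λ w → solution′ w j) (sym u≡anchor))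
    (λ flip → let (isolated≡false , anchor≗u) = ◂-≗ (Equivalence.to (flipAdjacent-head λ ()) flip) in
              Equivalence.from (neighbourhood u) (isolated≡false , sym (solution-injective′ anchor≗u)))

  adj⇔flipAdjacent : ∀ u w → Adj F u w ⇔ FlipAdjacent (solution u) (solution w)
  adj⇔flipAdjacent u w with punchIn-cases v u | punchIn-cases v w
  ... | inj₁ refl        | inj₁ refl        =
    mk⇔ (λ vv → contradiction vv (adj-irrefl F)) (λ flip → contradiction flip flipAdjacent-irrefl)
  ... | inj₁ refl        | inj₂ (w′ , refl) rewrite solution-v | solution-punchIn w′ = adj⇔flipAdjacent-fresh w′
  ... | inj₂ (u′ , refl) | inj₁ refl        rewrite solution-v | solution-punchIn u′ =
    mk⇔ (flipAdjacent-sym ∘ Equivalence.to (adj⇔flipAdjacent-fresh u′) ∘ adj-sym F)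
        (adj-sym F ∘ Equivalence.from (adj⇔flipAdjacent-fresh u′) ∘ flipAdjacent-sym)
  ... | inj₂ (u′ , refl) | inj₂ (w′ , refl) rewrite solution-punchIn u′ | solution-punchIn w′ =
    ⇔-trans (adj⇔flipAdjacent′ u′ w′) (⇔-sym (⇔-trans flipAdjacent-◂ flipAdjacent-◂))

  representation : FlipRepresentation F
  representation = record
    { constraints        = extended
    ; solution-satisfies = solution-satisfies
    ; solution-complete  = solution-complete
    ; solution-injective = solution-injective
    ; adj⇔flipAdjacent   = adj⇔flipAdjacent
    }

singletonRepresentation : (H : Graph 1) → FlipRepresentation H
singletonRepresentation H = record
  { size               = 0
  ; constraints        = λ ()
  ; solution           = λ _ ()
  ; solution-satisfies = λ _ ()
  ; solution-complete  = λ _ _ → zero , λ ()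
  ; solution-injective = λ { {zero} {zero} _ → refl }
  ; adj⇔flipAdjacent   = λ { zero zero → mk⇔ (λ vv → contradiction vv (adj-irrefl H)) λ { (() , _) } }
  }

-- Forests

forest-deleteVertex : ∀ {n} (F : Graph (suc n)) v → Forest F → Forest (deleteVertex F v)
forest-deleteVertex F v forest k (c , c-injective , c-adj , c-close) =
  forest k (punchIn v ∘ c , c-injective ∘ punchIn-injective v _ _ , c-adj , c-close)

AtMostOneNeighbour : ∀ {n} → Graph n → Fin n → Set
AtMostOneNeighbour F v = ∀ u w → Adj F v u → Adj F v w → u ≡ w

atMostOneNeighbour⇒neighbourhood : ∀ {n} (F : Graph (suc (suc n))) {v} → AtMostOneNeighbour F v →
  ∃₂ λ anchor isolated → ∀ u → Adj F v (punchIn v u) ⇔ (isolated ≡ false × u ≡ anchor)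
atMostOneNeighbour⇒neighbourhood F {v} atMostOne with any? (λ u → T? (adj F v (punchIn v u)))
... | yes (s , vs) = s , false , λ u → mk⇔
  (λ vu → refl , punchIn-injective v u s (atMostOne _ _ vu vs))
  (λ { (_ , refl) → vs })
... | no  isolated = zero , true , λ u → mk⇔ (λ vu → contradiction (u , vu) isolated) λ { (() , _) }

Branching : ∀ {n} → Graph n → Fin n → Set
Branching F c = ∃₂ λ u w → Adj F c u × Adj F c w × u ≢ w

module NonBacktrackingWalk {n} (F : Graph n) (branching : ∀ c → Branching F c) (start : Fin n) where

  first second : Fin n → Fin n
  first  c = let (u , _ , _) = branching c in u
  second c = let (_ , w , _) = branching c in w

  first-adj : ∀ c → Adj F c (first c)
  first-adj c = let (_ , _ , cu , _ , _) = branching c in cu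

  second-adj : ∀ c → Adj F c (second c)
  second-adj c = let (_ , _ , _ , cw , _) = branching c in cw

  first≢second : ∀ c → first c ≢ second c
  first≢second c = let (_ , _ , _ , _ , u≢w) = branching c in u≢w

  onward : Fin n → Fin n → Fin n
  onward p c with first c ≟ᶠ p
  ... | yes _ = second c
  ... | no  _ = first c

  onward-adj : ∀ p c → Adj F c (onward p c)
  onward-adj p c with first c ≟ᶠ p
  ... | yes _ = second-adj c
  ... | no  _ = first-adj c

  onward-≢ : ∀ p c → onward p c ≢ p
  onward-≢ p c with first c ≟ᶠ p
  ... | yes first≡p = λ second≡p → first≢second c (trans first≡p (sym second≡p))
  ... | no  first≢p = first≢p

  steps : ℕ → Fin n × Fin n
  steps zero    = start , first start
  steps (suc t) = proj₂ (steps t) , onward (proj₁ (steps t)) (proj₂ (steps t))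

  visit : ℕ → Fin n
  visit = proj₁ ∘ steps

  visit-adj : ∀ t → Adj F (visit t) (visit (suc t))
  visit-adj zero    = first-adj start
  visit-adj (suc t) = onward-adj (proj₁ (steps t)) (proj₂ (steps t))

  visit-nonBacktracking : ∀ t → visit (suc (suc t)) ≢ visit t
  visit-nonBacktracking t = onward-≢ (proj₁ (steps t)) (proj₂ (steps t))

  Revisits : ℕ → Set
  Revisits j = ∃ λ (i : Fin j) → visit (toℕ i) ≡ visit j

  firstRevisit : ∃ λ j → Revisits j × ∀ q → q < j → ¬ Revisits q
  firstRevisit =
    let (t , ¬¬revisits , earlier) =
          ¬∀⟶∃¬-smallest (suc n) (λ t → ¬ Revisits (toℕ t)) (λ t → ¬? (revisits? (toℕ t))) someRevisit
    in toℕ t , decidable-stable (revisits? (toℕ t)) ¬¬revisits ,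
       λ q q<t → earlier (fromℕ< q<t) ∘ subst Revisits (sym (trans (toℕ-inject _) (toℕ-fromℕ< q<t)))
    where
    revisits? : ∀ j → Dec (Revisits j)
    revisits? j = any? λ i → visit (toℕ i) ≟ᶠ visit j
    someRevisit : ¬ (∀ t → ¬ Revisits (toℕ t))
    someRevisit none = let (i , j , i<j , visitᵢ≡visitⱼ) = pigeonhole (ℕ.n<1+n n) (visit ∘ toℕ) in
                       none j (fromℕ< i<j , trans (cong visit (toℕ-fromℕ< i<j)) visitᵢ≡visitⱼ)

  cycle : ∃ λ k → Cycle F k
  cycle = closing (j ∸ i) (ℕ.m+[n∸m]≡n (ℕ.<⇒≤ i<j))
    where
    j = proj₁ firstRevisit
    i = toℕ (proj₁ (proj₁ (proj₂ firstRevisit)))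
    i<j : i < j
    i<j = toℕ<n (proj₁ (proj₁ (proj₂ firstRevisit)))
    visitᵢ≡visitⱼ : visit i ≡ visit j
    visitᵢ≡visitⱼ = proj₂ (proj₁ (proj₂ firstRevisit))
    distinct : ∀ p q → p < q → q < j → visit p ≢ visit q
    distinct p q p<q q<j same =
      proj₂ (proj₂ firstRevisit) q q<j (fromℕ< p<q , trans (cong visit (toℕ-fromℕ< p<q)) same)

    closing : ∀ d → i + d ≡ j → ∃ λ k → Cycle F k
    closing zero eq = contradiction (trans (sym (ℕ.+-identityʳ i)) eq) (ℕ.<⇒≢ i<j)
    closing (suc zero) eq =
      contradiction (subst (Adj F (visit i)) (trans (cong visit (trans (ℕ.+-comm 1 i) eq)) (sym visitᵢ≡visitⱼ))
                           (visit-adj i))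
                    (adj-irrefl F)
    closing (suc (suc zero)) eq =
      contradiction (trans (cong visit (trans (ℕ.+-comm 2 i) eq)) (sym visitᵢ≡visitⱼ)) (visit-nonBacktracking i)
    closing (suc (suc (suc k))) eq = k , c , c-injective , c-adj , c-close
      where
      c : Fin (suc (suc (suc k))) → Fin n
      c r = visit (i + toℕ r)
      within : ∀ r → i + toℕ r < j
      within r = subst (i + toℕ r <_) eq (ℕ.+-monoʳ-< i (toℕ<n r))
      c-injective : ∀ {r r′} → c r ≡ c r′ → r ≡ r′
      c-injective {r} {r′} cr≡cr′ with ℕ.<-cmp (toℕ r) (toℕ r′)
      ... | tri< r<r′ _ _ = contradiction cr≡cr′ (distinct _ _ (ℕ.+-monoʳ-< i r<r′) (within r′))
      ... | tri≈ _ r≡r′ _ = toℕ-injective r≡r′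
      ... | tri> _ _ r>r′ = contradiction (sym cr≡cr′) (distinct _ _ (ℕ.+-monoʳ-< i r>r′) (within r))
      c-adj : ∀ (r : Fin (suc (suc k))) → Adj F (c (inject₁ r)) (c (suc r))
      c-adj r = subst₂ (Adj F) (cong (λ x → visit (i + x)) (sym (toℕ-inject₁ r)))
                               (cong visit (sym (ℕ.+-suc i (toℕ r))))
                  (visit-adj (i + toℕ r))
      c-close : Adj F (c (fromℕ (suc (suc k)))) (c zero)
      c-close = subst₂ (Adj F) (cong (λ x → visit (i + x)) (sym (toℕ-fromℕ (suc (suc k)))))
                  (trans (cong visit (trans (sym (ℕ.+-suc i (suc (suc k)))) eq))
                         (trans (sym visitᵢ≡visitⱼ) (cong visit (sym (ℕ.+-identityʳ i)))))
                  (visit-adj (i + suc (suc k)))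

neighbourPair? : ∀ {n} (F : Graph n) c u w → Dec (Adj F c u → Adj F c w → u ≡ w)
neighbourPair? F c u w = T? (adj F c u) →-dec (T? (adj F c w) →-dec (u ≟ᶠ w))

atMostOneNeighbour? : ∀ {n} (F : Graph n) c → Dec (AtMostOneNeighbour F c)
atMostOneNeighbour? F c = all? λ u → all? (neighbourPair? F c u)

¬atMostOneNeighbour⇒branching : ∀ {n} (F : Graph n) {c} → ¬ AtMostOneNeighbour F c → Branching F c
¬atMostOneNeighbour⇒branching {n} F {c} ¬atMostOne
  with ¬∀⟶∃¬ n _ (λ u → all? (neighbourPair? F c u)) (λ every → ¬atMostOne λ u w → every u w)
... | u , ¬all with ¬∀⟶∃¬ n _ (neighbourPair? F c u) ¬all
...   | w , ¬neighbours with T? (adj F c u) | T? (adj F c w) | u ≟ᶠ w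
...     | yes cu | yes cw | no  u≢w = u , w , cu , cw , u≢w
...     | no ¬cu | _      | _       = contradiction (λ cu _ → contradiction cu ¬cu) ¬neighbours
...     | yes _  | no ¬cw | _       = contradiction (λ _ cw → contradiction cw ¬cw) ¬neighbours
...     | yes _  | yes _  | yes u≡w = contradiction (λ _ _ → u≡w) ¬neighbours

forest⇒atMostOneNeighbour : ∀ {n} (F : Graph n) → Forest F → Fin n → ∃ (AtMostOneNeighbour F)
forest⇒atMostOneNeighbour F forest start with any? (atMostOneNeighbour? F)
... | yes found = found
... | no  none  = contradiction (proj₂ Walk.cycle) (forest (proj₁ Walk.cycle))
  where
  module Walk = NonBacktrackingWalk F
                  (λ v → ¬atMostOneNeighbour⇒branching F λ atMostOne → none (v , atMostOne)) start

forestRepresentation : ∀ N (F : Graph (suc N)) → Forest F → FlipRepresentation F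
forestRepresentation zero    F _      = singletonRepresentation F
forestRepresentation (suc N) F forest =
  let (v , atMostOne)                     = forest⇒atMostOneNeighbour F forest zero
      (anchor , isolated , neighbourhood) = atMostOneNeighbour⇒neighbourhood F atMostOne
      R = forestRepresentation N (deleteVertex F v) (forest-deleteVertex F v forest)
  in ExtendRepresentation.representation F v R anchor isolated neighbourhood

theorem4p8 : ∀ (m : ℕ) (F : Graph (suc m)) → Forest F → IRealizable F
theorem4p8 m F forest = flipRepresentation⇒iRealizable (forestRepresentation m F forest)
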